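{- Let $p\geq 2$ be an even integer and let $G=(V,E)$ be a $(p,2)$-flex-connected graph with unsafe edge set $\mathcal{U}\subseteq E$. Let $\mathcal{F}$ be the family of violated sets of $G$. Then $\mathcal{F}$ is a pliable family, and $\mathcal{F}$ satisfies property $\gamma$.
   Context: $G=(V,E)$ is a finite graph (parallel edges allowed) whose edge set is partitioned into safe edges and unsafe edges; $\mathcal{U}$ denotes the set of unsafe edges. For $S\subseteq V$, $\delta(S)$ is the set of edges with exactly one endpoint in $S$. $G$ is $(p,2)$-flex-connected if for every $F\subseteq\mathcal{U}$ with $|F|\leq 2$ the graph $(V,E\setminus F)$ is $p$-edge-connected. A set $S\subseteq V$ is violated if $|\delta(S)|=p+2$ and $\delta(S)$ contains at least $3$ unsafe edges. Two sets $A,B\subseteq V$ cross if all four of $A\setminus B$, $A\cap B$, $B\setminus A$, $V\setminus(A\cup B)$ are nonempty. A family $\mathcal{F}\subseteq 2^V$ is pliable if for all $A,B\in\mathcal{F}$, $|\{A\cup B, A\cap B, A\setminus B, B\setminus A\}\cap\mathcal{F}|\geq 2$. A family $\mathcal{F}$ satisfies property $\gamma$ if for every set of vertex pairs $F'\subseteq V\times V$, letting $\mathcal{F}'=\{S\in\mathcal{F}: \text{no pair in } F' \text{ has exactly one endpoint in } S\}$, the following holds: whenever $C,S_1,S_2\in\mathcal{F}'$, $C$ is inclusion-wise minimal in $\mathcal{F}'$, $C$ crosses both $S_1$ and $S_2$, and $S_1\subseteq S_2$, the set $S_2\setminus(S_1\cup C)$ is either empty or violated (i.e. belongs to $\mathcal{F}$).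 -}

module Defs where

open import Data.Nat using (ℕ; _+_; _≤_)
open import Data.Nat.Divisibility using (_∣_)
open import Data.Bool using (Bool; true; false; _xor_; _∧_; not)
open import Data.Fin using (Fin; zero; suc)
open import Data.Sum using (_⊎_)
open import Relation.Nullary using (¬_)
open import Data.Fin.Subset using (Subset; _∈_; _⊆_; _∪_; _∩_; _─_; ∣_∣; Empty; Nonempty; ⊤)
open import Data.Vec using (lookup; tabulate)
open import Data.Product using (_×_; _,_; proj₁; proj₂; Σ)
open import Data.List using (List)
open import Data.List.Relation.Unary.All using (All)
open import Relation.Binary.PropositionalEquality using (_≡_)

-- A finite multigraph on vertex set Fin n with edge set Fin m.
-- Edge e has endpoints (ends e); unsafe e = true iff e ∈ 𝒰 (otherwise e is safe).
record Graph : Set where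
  field
    n      : ℕ
    m      : ℕ
    ends   : Fin m → Fin n × Fin n
    unsafe : Fin m → Bool
open Graph public

_∈ᵇ_ : ∀ {k} → Fin k → Subset k → Bool
v ∈ᵇ S = lookup S v

crosses? : (G : Graph) → Subset (n G) → Fin (m G) → Bool
crosses? G S e = (proj₁ (ends G e) ∈ᵇ S) xor (proj₂ (ends G e) ∈ᵇ S)

δ : (G : Graph) → Subset (m G) → Subset (n G) → Subset (m G)
δ G X S = tabulate (λ e → lookup X e ∧ crosses? G S e)

𝒰 : (G : Graph) → Subset (m G)
𝒰 G = tabulate (unsafe G)

EdgeConnected : (G : Graph) → ℕ → Subset (m G) → Set
EdgeConnected G p X =
  (S : Subset (n G)) → Nonempty S → Nonempty (⊤ ─ S) → p ≤ ∣ δ G X S ∣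

FlexConnected : (G : Graph) → ℕ → Set
FlexConnected G p =
  (F : Subset (m G)) → F ⊆ 𝒰 G → ∣ F ∣ ≤ 2 → EdgeConnected G p (⊤ ─ F)

Violated : (G : Graph) → ℕ → Subset (n G) → Set
Violated G p S = (∣ δ G ⊤ S ∣ ≡ p + 2) × (3 ≤ ∣ δ G ⊤ S ∩ 𝒰 G ∣)

Family : ℕ → Set₁
Family k = Subset k → Set

-- "At least two of X₁,X₂,X₃,X₄ belong to 𝓕", counting the four listed
-- positions (i.e. with multiplicity): two distinct indices i ≠ j with pick i, pick j ∈ 𝓕.
pick4 : ∀ {k} → Subset k → Subset k → Subset k → Subset k → Fin 4 → Subset k
pick4 X₁ X₂ X₃ X₄ zero = X₁
pick4 X₁ X₂ X₃ X₄ (suc zero) = X₂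
pick4 X₁ X₂ X₃ X₄ (suc (suc zero)) = X₃
pick4 X₁ X₂ X₃ X₄ (suc (suc (suc zero))) = X₄

AtLeastTwoOf4 : ∀ {k} → Family k → Subset k → Subset k → Subset k → Subset k → Set
AtLeastTwoOf4 𝓕 X₁ X₂ X₃ X₄ =
  Σ (Fin 4) λ i → Σ (Fin 4) λ j →
    (¬ i ≡ j) × 𝓕 (pick4 X₁ X₂ X₃ X₄ i) × 𝓕 (pick4 X₁ X₂ X₃ X₄ j)

Pliable : ∀ {k} → Family k → Set
Pliable 𝓕 = ∀ A B → 𝓕 A → 𝓕 B → AtLeastTwoOf4 𝓕 (A ∪ B) (A ∩ B) (A ─ B) (B ─ A)

Cross : ∀ {k} → Subset k → Subset k → Set
Cross A B = Nonempty (A ─ B) × Nonempty (A ∩ B) × Nonempty (B ─ A) × Nonempty (⊤ ─ (A ∪ B))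

Separates : ∀ {k} → Subset k → Fin k × Fin k → Set
Separates S (u , v) = ((u ∈ᵇ S) xor (v ∈ᵇ S)) ≡ true

Restrict : ∀ {k} → Family k → List (Fin k × Fin k) → Family k
Restrict 𝓕 F' S = 𝓕 S × All (λ q → ¬ Separates S q) F'

Minimal : ∀ {k} → Family k → Subset k → Set
Minimal 𝓕 C = 𝓕 C × (∀ D → 𝓕 D → D ⊆ C → D ≡ C)

PropertyGamma : ∀ {k} → Family k → Set
PropertyGamma 𝓕 =
  (F' : List (Fin _ × Fin _)) → (C S₁ S₂ : Subset _) →
  Minimal (Restrict 𝓕 F') C → Restrict 𝓕 F' S₁ → Restrict 𝓕 F' S₂ →
  Cross C S₁ → Cross C S₂ → S₁ ⊆ S₂ →
  Empty (S₂ ─ (S₁ ∪ C)) ⊎ 𝓕 (S₂ ─ (S₁ ∪ C))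

module Submission where

-- Write d(S) = |δ(S)| and u(S) for the number of unsafe edges in δ(S). Deleting up to two unsafe
-- edges of δ(S) shows d(S) ≥ p + min(2, u(S)) for every proper nonempty S. For crossing violated
-- A and B, the identities d(A∩B) + d(A∪B) + 2e(A─B, B─A) = d(A) + d(B) = d(A─B) + d(B─A) +
-- 2e(A∩B, V─(A∪B)) leave the excesses over p of the four cuts only a few possibilities, and
-- d(A∩B) ≡ d(A─B) mod 2 because p is even. Since every unsafe edge of δ(A) lies in δ(A∩B) or
-- δ(A─B) (and likewise for three other pairs), a short case analysis shows that A∩B and A∪B are
-- both violated, or A─B and B─A are, or all four cuts have size p + 2, no edge joins A─B to B─A
-- or A∩B to V─(A∪B), and one set of each pair is violated. If A and B do not cross, two of the
-- four sets are A and B or their complements.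
--
-- For property γ, minimality of C means C∩Sᵢ and C─Sᵢ are not violated, so the last case holds
-- for (C, S₁) and (C, S₂). Counting then gives d(T) + 2e(S₁─C, V─(C∪S₂)) ≤ p + 2 for
-- T = S₂─(S₁∪C), while the at least three unsafe edges of δ(S₁) all run from S₁─C to T or to
-- V─(C∪S₂); together with d(T) ≥ p + min(2, u(T)) this forces T to be violated.
--
-- Each identity between edge counts is proved by double counting: the contribution of an edge
-- depends only on its type (which of the sets involved contain its ends, and whether it is
-- unsafe), and the finitely many types are checked by evaluation.

open import Defs
open import Data.Nat
  using (ℕ; zero; suc; _+_; _*_; _∸_; _≤_; _⊓_; _≤?_; _≤ᵇ_; _≡ᵇ_; z≤n; s≤s)
open import Data.Nat.Tactic.RingSolver using (solve-∀)
open import Data.Nat.Properties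
open import Data.Bool using (Bool; true; false; T; not; _∧_; _∨_; _xor_; if_then_else_)
open import Data.Bool.Properties
  using (T-∧; T-≡; ∧-zeroʳ; ∧-identityʳ; not-involutive; not-distribˡ-xor; not-distribʳ-xor)
open import Data.Fin using (Fin; zero; suc)
open import Data.Fin.Patterns using (0F; 1F; 2F; 3F)
open import Data.Fin.Subset
  using (Subset; _∈_; _∉_; _⊆_; _∪_; _∩_; _─_; ∣_∣; ⊤; Empty; Nonempty) renaming (⊥ to ∅)
open import Data.Fin.Subset.Properties
  using (nonempty?; ∉⊥; ∈⊤; ∣⊥∣≡0; p∩q⊆p; p∩q⊆q; p⊆p∪q; p─q⊆p; x∈p∧x∉q⇒x∈p─q)
open import Data.Empty using (⊥; ⊥-elim)
open import Data.Sum using (_⊎_; inj₁; inj₂)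
open import Data.Nat.Divisibility using (_∣_; _∣?_; divides; ∣m+n∣m⇒∣n; ∣-refl)
open import Relation.Nullary using (¬_; yes; no)
open import Relation.Nullary.Decidable using (from-no)
open import Data.List using (List; []; _∷_; foldl)
open import Data.List.Relation.Unary.All as All using (All)
open import Data.List.NonEmpty using (List⁺; _∷_)
open import Data.Vec using (Vec; []; _∷_; here; there; lookup)
open import Data.Vec.Properties
  using (lookup∘tabulate; lookup-replicate; lookup-zipWith; []=⇒lookup; lookup⇒[]=)
open import Data.Product using (_×_; _,_; proj₁; proj₂)
open import Function using (_∘_; Equivalence)
open import Relation.Binary.PropositionalEquality
open import Algebra.Properties.CommutativeMonoid.Sum +-0-commutativeMonoid
  using (sum; ∑-distrib-+; sum-cong-≋)

-- Counting

indicator : Bool → ℕ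
indicator true  = 1
indicator false = 0

count : ∀ {m} → (Fin m → Bool) → ℕ
count f = sum (indicator ∘ f)

count-cong : ∀ {m} {f g : Fin m → Bool} → (∀ e → f e ≡ g e) → count f ≡ count g
count-cong f≗g = sum-cong-≋ (cong indicator ∘ f≗g)

count-+ : ∀ {m} {f g h : Fin m → Bool} →
  (∀ e → indicator (f e) + indicator (g e) ≡ indicator (h e)) → count f + count g ≡ count h
count-+ {f = f} {g} pointwise =
  trans (sym (∑-distrib-+ (indicator ∘ f) (indicator ∘ g))) (sum-cong-≋ pointwise)

∣∣≡count : ∀ {m} (S : Subset m) → ∣ S ∣ ≡ count (lookup S)
∣∣≡count []          = refl
∣∣≡count (true ∷ S)  = cong suc (∣∣≡count S)
∣∣≡count (false ∷ S) = ∣∣≡count S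

sum-mono-≤ : ∀ {m} {f g : Fin m → ℕ} → (∀ i → f i ≤ g i) → sum f ≤ sum g
sum-mono-≤ {zero}  f≤g = z≤n
sum-mono-≤ {suc m} f≤g = +-mono-≤ (f≤g zero) (sum-mono-≤ (f≤g ∘ suc))

-- Left-nested, so that Σ⁺ f (x ∷ y ∷ []) is f x + f y, with no trailing + 0.
Σ⁺ : ∀ {A : Set} → (A → ℕ) → List⁺ A → ℕ
Σ⁺ f (x ∷ xs) = foldl (λ acc y → acc + f y) (f x) xs

foldl-sum-comm : ∀ {A : Set} {m} (f : A → Fin m → ℕ) (g : Fin m → ℕ) xs →
  foldl (λ acc y → acc + sum (f y)) (sum g) xs ≡ sum (λ i → foldl (λ acc y → acc + f y i) (g i) xs)
foldl-sum-comm f g []       = refl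
foldl-sum-comm f g (x ∷ xs) =
  trans (cong (λ acc → foldl _ acc xs) (sym (∑-distrib-+ g (f x))))
        (foldl-sum-comm f (λ i → g i + f x i) xs)

Σ⁺-sum-comm : ∀ {A : Set} {m} (f : A → Fin m → ℕ) xs →
  Σ⁺ (sum ∘ f) xs ≡ sum (λ i → Σ⁺ (λ x → f x i) xs)
Σ⁺-sum-comm f (x ∷ xs) = foldl-sum-comm f (f x) xs

multiplicity : ∀ {A : Set} → List⁺ (A → Bool) → A → ℕ
multiplicity Fs a = Σ⁺ (λ F → indicator (F a)) Fs

double-counting : ∀ {B : Set} {m} (τ : Fin m → B) (Fs Gs : List⁺ (B → Bool)) →
  (∀ e → multiplicity Fs (τ e) ≤ multiplicity Gs (τ e)) →
  Σ⁺ (λ F → count (F ∘ τ)) Fs ≤ Σ⁺ (λ F → count (F ∘ τ)) Gs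
double-counting τ Fs Gs Fs≤Gs = begin
  Σ⁺ (λ F → count (F ∘ τ)) Fs   ≡⟨ Σ⁺-sum-comm (λ F → indicator ∘ F ∘ τ) Fs ⟩
  sum (multiplicity Fs ∘ τ)     ≤⟨ sum-mono-≤ Fs≤Gs ⟩
  sum (multiplicity Gs ∘ τ)     ≡⟨ Σ⁺-sum-comm (λ F → indicator ∘ F ∘ τ) Gs ⟨
  Σ⁺ (λ F → count (F ∘ τ)) Gs   ∎
  where open ≤-Reasoning

T-if : ∀ {c a} → T c → T (if c then a else true) → T a
T-if {true} _ t = t

T-both : ∀ (P : Bool → Bool) w → T (P true ∧ P false) → T (P w)
T-both P true  t = proj₁ (Equivalence.to T-∧ t)
T-both P false t = proj₂ (Equivalence.to T-∧ t)

equal-unless : ∀ {c a b} → c ≡ false → T (c ∨ not (a xor b)) → a ≡ b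
equal-unless {a = true}  {true}  refl _  = refl
equal-unless {a = true}  {false} refl ()
equal-unless {a = false} {true}  refl ()
equal-unless {a = false} {false} refl _  = refl

xor≢true⇒≡ : ∀ {a b} → ¬ (a xor b ≡ true) → a ≡ b
xor≢true⇒≡ {true}  {true}  _     = refl
xor≢true⇒≡ {false} {false} _     = refl
xor≢true⇒≡ {true}  {false} a≢b   = ⊥-elim (a≢b refl)
xor≢true⇒≡ {false} {true}  a≢b   = ⊥-elim (a≢b refl)

≡⇒xor≢true : ∀ {a b} → a ≡ b → ¬ (a xor b ≡ true)
≡⇒xor≢true {true}  refl ()
≡⇒xor≢true {false} refl ()

lookup-─ : ∀ {k} (p q : Subset k) i → lookup (p ─ q) i ≡ lookup p i ∧ not (lookup q i)
lookup-─ (x ∷ p) (true  ∷ q) zero    = sym (∧-zeroʳ x)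
lookup-─ (x ∷ p) (false ∷ q) zero    = sym (∧-identityʳ x)
lookup-─ (_ ∷ p) (_     ∷ q) (suc i) = lookup-─ p q i

x∈p─q⇒x∉q : ∀ {k} {p q : Subset k} {x} → x ∈ p ─ q → x ∉ q
x∈p─q⇒x∉q {p = true ∷ p} {false ∷ q} here ()
x∈p─q⇒x∉q {p = _ ∷ p} {_ ∷ q} (there x∈p─q) (there x∈q) = x∈p─q⇒x∉q x∈p─q x∈q

empty⇒∉ : ∀ {k} {E : Subset k} → Empty E → ∀ v → v ∈ᵇ E ≡ false
empty⇒∉ {E = E} E≡∅ v with v ∈ᵇ E in v∈E
... | true  = ⊥-elim (E≡∅ (v , lookup⇒[]= v E v∈E))
... | false = refl

Nonempty-mono : ∀ {k} {P Q : Subset k} → P ⊆ Q → Nonempty P → Nonempty Q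
Nonempty-mono P⊆Q (x , x∈P) = x , P⊆Q x∈P

disjoint⇒complement-nonempty : ∀ {k} {P Q : Subset k} → (∀ {x} → x ∈ P → x ∉ Q) →
  Nonempty P → Nonempty (⊤ ─ Q)
disjoint⇒complement-nonempty P∩Q≡∅ =
  Nonempty-mono λ x∈P → x∈p∧x∉q⇒x∈p─q ∈⊤ (P∩Q≡∅ x∈P)

first : ∀ {m} → ℕ → Subset m → Subset m
first zero    _           = ∅
first (suc k) []          = []
first (suc k) (true ∷ S)  = true ∷ first k S
first (suc k) (false ∷ S) = false ∷ first (suc k) S

first-⊆ : ∀ {m} k (S : Subset m) → first k S ⊆ S
first-⊆ zero    S           x∈       = ⊥-elim (∉⊥ x∈)
first-⊆ (suc k) (true ∷ S)  here     = here
first-⊆ (suc k) (true ∷ S)  (there x∈) = there (first-⊆ k S x∈)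
first-⊆ (suc k) (false ∷ S) (there x∈) = there (first-⊆ (suc k) S x∈)

∣first∣ : ∀ {m} k (S : Subset m) → ∣ first k S ∣ ≡ k ⊓ ∣ S ∣
∣first∣ {m} zero    S           = ∣⊥∣≡0 m
∣first∣ (suc k) []          = refl
∣first∣ (suc k) (true ∷ S)  = cong suc (∣first∣ k S)
∣first∣ (suc k) (false ∷ S) = ∣first∣ (suc k) S

-- The type of an edge with respect to k vertex sets: the membership vectors of its
-- two ends, and whether it is unsafe.
EdgeType : ℕ → Set
EdgeType k = Vec Bool k × Vec Bool k × Bool

allᵇ : ∀ k → (Vec Bool k → Bool) → Bool
allᵇ zero    P = P []
allᵇ (suc k) P = allᵇ k (P ∘ (true ∷_)) ∧ allᵇ k (P ∘ (false ∷_))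

allᵇ-sound : ∀ {k} (P : Vec Bool k → Bool) → T (allᵇ k P) → ∀ v → T (P v)
allᵇ-sound P h []          = h
allᵇ-sound P h (true ∷ v)  = allᵇ-sound _ (proj₁ (Equivalence.to T-∧ h)) v
allᵇ-sound P h (false ∷ v) = allᵇ-sound _ (proj₂ (Equivalence.to T-∧ h)) v

edgewise : ∀ {k} → (Vec Bool k → Bool) → (ℕ → ℕ → Bool) →
  List⁺ (EdgeType k → Bool) → List⁺ (EdgeType k → Bool) → Bool
edgewise {k} admissible R Fs Gs = allᵇ k λ x → allᵇ k λ y →
  if admissible x ∧ admissible y then holds (x , y , true) ∧ holds (x , y , false) else true
  where
  holds : EdgeType k → Bool
  holds β = R (multiplicity Fs β) (multiplicity Gs β)

edgewise-sound : ∀ {k} {admissible : Vec Bool k → Bool} {R Fs Gs} →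
  T (edgewise admissible R Fs Gs) → ∀ x y w → T (admissible x) → T (admissible y) →
  T (R (multiplicity Fs (x , y , w)) (multiplicity Gs (x , y , w)))
edgewise-sound {R = R} {Fs} {Gs} h x y w adm-x adm-y =
  T-both (λ w → R (multiplicity Fs (x , y , w)) (multiplicity Gs (x , y , w))) w
    (T-if (Equivalence.from T-∧ (adm-x , adm-y)) (allᵇ-sound _ (allᵇ-sound _ h x) y))

crossing : ∀ {k} → (Vec Bool k → Bool) → EdgeType k → Bool
crossing φ (x , y , _) = φ x xor φ y

joining : ∀ {k} → (Vec Bool k → Bool) → (Vec Bool k → Bool) → EdgeType k → Bool
joining φ ψ (x , y , _) = (φ x ∧ ψ y) ∨ (ψ x ∧ φ y)

unsafeOnly : ∀ {k} → (EdgeType k → Bool) → EdgeType k → Bool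
unsafeOnly F β = F β ∧ proj₂ (proj₂ β)

-- Cuts

module Cuts (G : Graph) where

  d u : Subset (n G) → ℕ
  d S = ∣ δ G ⊤ S ∣
  u S = ∣ δ G ⊤ S ∩ 𝒰 G ∣

  joins : Subset (n G) → Subset (n G) → Fin (m G) → Bool
  joins X Y e = (x ∈ᵇ X ∧ y ∈ᵇ Y) ∨ (x ∈ᵇ Y ∧ y ∈ᵇ X)
    where
    x = proj₁ (ends G e)
    y = proj₂ (ends G e)

  between unsafeBetween : Subset (n G) → Subset (n G) → ℕ
  between X Y       = count (joins X Y)
  unsafeBetween X Y = count (λ e → joins X Y e ∧ unsafe G e)

  unsafeBetween≤between : ∀ X Y → unsafeBetween X Y ≤ between X Y
  unsafeBetween≤between X Y = sum-mono-≤ λ e → indicator-∧ (joins X Y e) (unsafe G e)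
    where
    indicator-∧ : ∀ a b → indicator (a ∧ b) ≤ indicator a
    indicator-∧ true  true  = ≤-refl
    indicator-∧ true  false = z≤n
    indicator-∧ false _     = z≤n

  lookup-δ : ∀ S e → lookup (δ G ⊤ S) e ≡ crosses? G S e
  lookup-δ S e = trans (lookup∘tabulate _ e) (cong (_∧ crosses? G S e) (lookup-replicate e true))

  d≡count : ∀ S → d S ≡ count (crosses? G S)
  d≡count S = trans (∣∣≡count (δ G ⊤ S)) (count-cong (lookup-δ S))

  u≡count : ∀ S → u S ≡ count (λ e → crosses? G S e ∧ unsafe G e)
  u≡count S = trans (∣∣≡count (δ G ⊤ S ∩ 𝒰 G)) (count-cong λ e →
    trans (lookup-zipWith _∧_ e (δ G ⊤ S) (𝒰 G))
          (cong₂ _∧_ (lookup-δ S e) (lookup∘tabulate (unsafe G) e)))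

  crosses-cong : ∀ S R → (∀ v → v ∈ᵇ S ≡ v ∈ᵇ R) → ∀ e → crosses? G S e ≡ crosses? G R e
  crosses-cong S R S≗R e = cong₂ _xor_ (S≗R (proj₁ (ends G e))) (S≗R (proj₂ (ends G e)))

  crosses-complement : ∀ S e → crosses? G (⊤ ─ S) e ≡ crosses? G S e
  crosses-complement S e = begin
    x ∈ᵇ (⊤ ─ S) xor y ∈ᵇ (⊤ ─ S)   ≡⟨ cong₂ _xor_ (∈ᵇ-complement x) (∈ᵇ-complement y) ⟩
    not (x ∈ᵇ S) xor not (y ∈ᵇ S)   ≡⟨ not-distribˡ-xor (x ∈ᵇ S) (not (y ∈ᵇ S)) ⟨
    not (x ∈ᵇ S xor not (y ∈ᵇ S))   ≡⟨ cong not (not-distribʳ-xor (x ∈ᵇ S) (y ∈ᵇ S)) ⟨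
    not (not (x ∈ᵇ S xor y ∈ᵇ S))   ≡⟨ not-involutive _ ⟩
    x ∈ᵇ S xor y ∈ᵇ S               ∎
    where
    open ≡-Reasoning
    x = proj₁ (ends G e)
    y = proj₂ (ends G e)
    ∈ᵇ-complement : ∀ v → v ∈ᵇ (⊤ ─ S) ≡ not (v ∈ᵇ S)
    ∈ᵇ-complement v = trans (lookup-─ ⊤ S v) (cong (_∧ not (v ∈ᵇ S)) (lookup-replicate v true))

  d-cong : ∀ S R → (∀ e → crosses? G S e ≡ crosses? G R e) → d S ≡ d R
  d-cong S R same = trans (d≡count S) (trans (count-cong same) (sym (d≡count R)))

  u-cong : ∀ S R → (∀ e → crosses? G S e ≡ crosses? G R e) → u S ≡ u R
  u-cong S R same =
    trans (u≡count S) (trans (count-cong λ e → cong (_∧ unsafe G e) (same e)) (sym (u≡count R)))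

  violated-crosses : ∀ {p} S R → (∀ e → crosses? G S e ≡ crosses? G R e) →
                     Violated G p R → Violated G p S
  violated-crosses S R same (dR≡p+2 , 3≤uR) =
    trans (d-cong S R same) dR≡p+2 , subst (3 ≤_) (sym (u-cong S R same)) 3≤uR

  violated-cong : ∀ {p} S R → (∀ v → v ∈ᵇ S ≡ v ∈ᵇ R) → Violated G p R → Violated G p S
  violated-cong S R S≗R = violated-crosses S R (crosses-cong S R S≗R)

  violated-complement : ∀ {p} S → Violated G p S → Violated G p (⊤ ─ S)
  violated-complement S = violated-crosses (⊤ ─ S) S (crosses-complement S)

  ∣δ─F∣+∣F∣≡d : ∀ {F} S → F ⊆ δ G ⊤ S → ∣ δ G (⊤ ─ F) S ∣ + ∣ F ∣ ≡ d S
  ∣δ─F∣+∣F∣≡d {F} S F⊆δ = begin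
    ∣ δ G (⊤ ─ F) S ∣ + ∣ F ∣
      ≡⟨ cong₂ _+_ (∣∣≡count (δ G (⊤ ─ F) S)) (∣∣≡count F) ⟩
    count (lookup (δ G (⊤ ─ F) S)) + count (lookup F)
      ≡⟨ count-+ pointwise ⟩
    count (lookup (δ G ⊤ S))
      ≡⟨ ∣∣≡count (δ G ⊤ S) ⟨
    d S ∎
    where
    open ≡-Reasoning
    pointwise : ∀ e → indicator (lookup (δ G (⊤ ─ F) S) e) + indicator (lookup F e)
                      ≡ indicator (lookup (δ G ⊤ S) e)
    pointwise e rewrite lookup∘tabulate (λ e → lookup (⊤ ─ F) e ∧ crosses? G S e) e
                      | lookup-─ ⊤ F e | lookup-replicate e true | lookup-δ S e
      with lookup F e in e∈F
    ... | true  = cong indicator (sym e-crosses)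
      where
      e-crosses : crosses? G S e ≡ true
      e-crosses = trans (sym (lookup-δ S e)) ([]=⇒lookup (F⊆δ (lookup⇒[]= e F e∈F)))
    ... | false = +-identityʳ _

  flex-bound : ∀ {p} → FlexConnected G p → ∀ {S} → Nonempty S → Nonempty (⊤ ─ S) →
               p + 2 ⊓ u S ≤ d S
  flex-bound {p} flex {S} S≠∅ Sᶜ≠∅ = begin
    p + 2 ⊓ u S                  ≤⟨ +-monoˡ-≤ _ (flex F F⊆𝒰 ∣F∣≤2 S S≠∅ Sᶜ≠∅) ⟩
    ∣ δ G (⊤ ─ F) S ∣ + 2 ⊓ u S  ≡⟨ cong (∣ δ G (⊤ ─ F) S ∣ +_) ∣F∣ ⟨
    ∣ δ G (⊤ ─ F) S ∣ + ∣ F ∣    ≡⟨ ∣δ─F∣+∣F∣≡d S F⊆δ ⟩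
    d S                          ∎
    where
    open ≤-Reasoning
    F = first 2 (δ G ⊤ S ∩ 𝒰 G)
    ∣F∣ : ∣ F ∣ ≡ 2 ⊓ u S
    ∣F∣ = ∣first∣ 2 (δ G ⊤ S ∩ 𝒰 G)
    F⊆δ : F ⊆ δ G ⊤ S
    F⊆δ x∈F = p∩q⊆p (δ G ⊤ S) (𝒰 G) (first-⊆ 2 _ x∈F)
    F⊆𝒰 : F ⊆ 𝒰 G
    F⊆𝒰 x∈F = p∩q⊆q (δ G ⊤ S) (𝒰 G) (first-⊆ 2 _ x∈F)
    ∣F∣≤2 : ∣ F ∣ ≤ 2
    ∣F∣≤2 = subst (_≤ 2) (sym ∣F∣) (m⊓n≤m 2 _)

module Labelling (G : Graph) {k} (label : Fin (n G) → Vec Bool k) where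
  open Cuts G

  edgeType : Fin (m G) → EdgeType k
  edgeType e = label (proj₁ (ends G e)) , label (proj₂ (ends G e)) , unsafe G e

  edgeCount : (EdgeType k → Bool) → ℕ
  edgeCount F = count (F ∘ edgeType)

  record Represents (S : Subset (n G)) (φ : Vec Bool k → Bool) : Set where
    constructor represents
    field membership : ∀ v → v ∈ᵇ S ≡ φ (label v)

  ⊤-represents : Represents ⊤ (λ _ → true)
  ⊤-represents = represents λ v → lookup-replicate v true

  ∩-represents : ∀ {S R φ ψ} → Represents S φ → Represents R ψ →
                 Represents (S ∩ R) (λ x → φ x ∧ ψ x)
  ∩-represents {S} {R} (represents S≗φ) (represents R≗ψ) = represents λ v →
    trans (lookup-zipWith _∧_ v S R) (cong₂ _∧_ (S≗φ v) (R≗ψ v))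

  ∪-represents : ∀ {S R φ ψ} → Represents S φ → Represents R ψ →
                 Represents (S ∪ R) (λ x → φ x ∨ ψ x)
  ∪-represents {S} {R} (represents S≗φ) (represents R≗ψ) = represents λ v →
    trans (lookup-zipWith _∨_ v S R) (cong₂ _∨_ (S≗φ v) (R≗ψ v))

  ─-represents : ∀ {S R φ ψ} → Represents S φ → Represents R ψ →
                 Represents (S ─ R) (λ x → φ x ∧ not (ψ x))
  ─-represents {S} {R} (represents S≗φ) (represents R≗ψ) = represents λ v →
    trans (lookup-─ S R v) (cong₂ (λ a b → a ∧ not b) (S≗φ v) (R≗ψ v))

  d-represented : ∀ {S φ} → Represents S φ → d S ≡ edgeCount (crossing φ)
  d-represented {S} (represents S≗φ) = trans (d≡count S) (count-cong λ e →
    cong₂ _xor_ (S≗φ (proj₁ (ends G e))) (S≗φ (proj₂ (ends G e))))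

  u-represented : ∀ {S φ} → Represents S φ → u S ≡ edgeCount (unsafeOnly (crossing φ))
  u-represented {S} (represents S≗φ) = trans (u≡count S) (count-cong λ e →
    cong (_∧ unsafe G e) (cong₂ _xor_ (S≗φ (proj₁ (ends G e))) (S≗φ (proj₂ (ends G e)))))

  joins-represented : ∀ {X Y φ ψ} → Represents X φ → Represents Y ψ →
                      ∀ e → joins X Y e ≡ joining φ ψ (edgeType e)
  joins-represented (represents X≗φ) (represents Y≗ψ) e =
    cong₂ _∨_ (cong₂ _∧_ (X≗φ x) (Y≗ψ y)) (cong₂ _∧_ (Y≗ψ x) (X≗φ y))
    where
    x = proj₁ (ends G e)
    y = proj₂ (ends G e)

  between-represented : ∀ {X Y φ ψ} → Represents X φ → Represents Y ψ →
                        between X Y ≡ edgeCount (joining φ ψ)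
  between-represented X≗φ Y≗ψ = count-cong (joins-represented X≗φ Y≗ψ)

  unsafeBetween-represented : ∀ {X Y φ ψ} → Represents X φ → Represents Y ψ →
                              unsafeBetween X Y ≡ edgeCount (unsafeOnly (joining φ ψ))
  unsafeBetween-represented X≗φ Y≗ψ =
    count-cong λ e → cong (_∧ unsafe G e) (joins-represented X≗φ Y≗ψ e)

  agree-off : ∀ {E S R χ φ ψ} → Represents E χ → Represents S φ → Represents R ψ →
              T (allᵇ k λ x → χ x ∨ not (φ x xor ψ x)) → Empty E → ∀ v → v ∈ᵇ S ≡ v ∈ᵇ R
  agree-off (represents E≗χ) (represents S≗φ) (represents R≗ψ) check E≡∅ v =
    trans (S≗φ v) (trans (equal-unless χv≡false (allᵇ-sound _ check (label v))) (sym (R≗ψ v)))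
    where
    χv≡false = trans (sym (E≗χ v)) (empty⇒∉ E≡∅ v)

  module Counting (admissible : Vec Bool k → Bool)
                  (label-admissible : ∀ v → T (admissible (label v))) where

    edgewise-holds : ∀ R Fs Gs → T (edgewise admissible R Fs Gs) →
                     ∀ e → T (R (multiplicity Fs (edgeType e)) (multiplicity Gs (edgeType e)))
    edgewise-holds R Fs Gs check e = edgewise-sound {admissible = admissible} {R} {Fs} {Gs} check
      _ _ _ (label-admissible _) (label-admissible _)

    count-≤ : ∀ Fs Gs → T (edgewise admissible _≤ᵇ_ Fs Gs) → Σ⁺ edgeCount Fs ≤ Σ⁺ edgeCount Gs
    count-≤ Fs Gs check = double-counting edgeType Fs Gs λ e →
      ≤ᵇ⇒≤ _ _ (edgewise-holds _≤ᵇ_ Fs Gs check e)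

    count-≡ : ∀ Fs Gs → T (edgewise admissible _≡ᵇ_ Fs Gs) → Σ⁺ edgeCount Fs ≡ Σ⁺ edgeCount Gs
    count-≡ Fs Gs check = ≤-antisym
      (double-counting edgeType Fs Gs (≤-reflexive ∘ pointwise))
      (double-counting edgeType Gs Fs (≤-reflexive ∘ sym ∘ pointwise))
      where
      pointwise : ∀ e → multiplicity Fs (edgeType e) ≡ multiplicity Gs (edgeType e)
      pointwise e = ≡ᵇ⇒≡ _ _ (edgewise-holds _≡ᵇ_ Fs Gs check e)

module TwoSets (G : Graph) (A B : Subset (n G)) where
  open Cuts G

  label : Fin (n G) → Vec Bool 2
  label v = v ∈ᵇ A ∷ v ∈ᵇ B ∷ []

  open Labelling G label public
  open Counting (λ _ → true) (λ _ → _)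

  inA inB inA∩B inA∪B inA─B inB─A neither : Vec Bool 2 → Bool
  inA (a ∷ _)      = a
  inB (_ ∷ b ∷ []) = b
  inA∩B x   = inA x ∧ inB x
  inA∪B x   = inA x ∨ inB x
  inA─B x   = inA x ∧ not (inB x)
  inB─A x   = inB x ∧ not (inA x)
  neither x = true ∧ not (inA∪B x)

  A-rep : Represents A inA
  A-rep = represents λ _ → refl

  B-rep : Represents B inB
  B-rep = represents λ _ → refl

  A∩B-rep : Represents (A ∩ B) inA∩B
  A∩B-rep = ∩-represents A-rep B-rep

  A∪B-rep : Represents (A ∪ B) inA∪B
  A∪B-rep = ∪-represents A-rep B-rep

  A─B-rep : Represents (A ─ B) inA─B
  A─B-rep = ─-represents A-rep B-rep

  B─A-rep : Represents (B ─ A) inB─A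
  B─A-rep = ─-represents B-rep A-rep

  neither-rep : Represents (⊤ ─ (A ∪ B)) neither
  neither-rep = ─-represents ⊤-represents A∪B-rep

  d-submodular : d (A ∩ B) + d (A ∪ B) + between (A ─ B) (B ─ A) + between (A ─ B) (B ─ A) ≡ d A + d B
  d-submodular
    rewrite d-represented A∩B-rep | d-represented A∪B-rep | between-represented A─B-rep B─A-rep
          | d-represented A-rep | d-represented B-rep
    = count-≡ (crossing inA∩B ∷ crossing inA∪B ∷ joining inA─B inB─A ∷ joining inA─B inB─A ∷ [])
              (crossing inA ∷ crossing inB ∷ []) _

  d-posimodular : d (A ─ B) + d (B ─ A) + between (A ∩ B) (⊤ ─ (A ∪ B))
                                      + between (A ∩ B) (⊤ ─ (A ∪ B)) ≡ d A + d B
  d-posimodular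
    rewrite d-represented A─B-rep | d-represented B─A-rep | between-represented A∩B-rep neither-rep
          | d-represented A-rep | d-represented B-rep
    = count-≡ (crossing inA─B ∷ crossing inB─A ∷ joining inA∩B neither ∷ joining inA∩B neither ∷ [])
              (crossing inA ∷ crossing inB ∷ []) _

  d-split : d (A ∩ B) + d (A ─ B) ≡ d A + between (A ∩ B) (A ─ B) + between (A ∩ B) (A ─ B)
  d-split
    rewrite d-represented A∩B-rep | d-represented A─B-rep | d-represented A-rep
          | between-represented A∩B-rep A─B-rep
    = count-≡ (crossing inA∩B ∷ crossing inA─B ∷ [])
              (crossing inA ∷ joining inA∩B inA─B ∷ joining inA∩B inA─B ∷ []) _

  u-split : u A + unsafeBetween (A ∩ B) (A ─ B) + unsafeBetween (A ∩ B) (A ─ B) ≤ u (A ∩ B) + u (A ─ B)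
  u-split
    rewrite u-represented A-rep | unsafeBetween-represented A∩B-rep A─B-rep
          | u-represented A∩B-rep | u-represented A─B-rep
    = count-≤ (unsafeOnly (crossing inA) ∷ unsafeOnly (joining inA∩B inA─B)
                 ∷ unsafeOnly (joining inA∩B inA─B) ∷ [])
              (unsafeOnly (crossing inA∩B) ∷ unsafeOnly (crossing inA─B) ∷ []) _

  u-submodular : u A + u B ≤ u (A ∩ B) + u (A ∪ B) + between (A ─ B) (B ─ A) + between (A ─ B) (B ─ A)
  u-submodular
    rewrite u-represented A-rep | u-represented B-rep | u-represented A∩B-rep | u-represented A∪B-rep
          | between-represented A─B-rep B─A-rep
    = count-≤ (unsafeOnly (crossing inA) ∷ unsafeOnly (crossing inB) ∷ [])
              (unsafeOnly (crossing inA∩B) ∷ unsafeOnly (crossing inA∪B)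
                 ∷ joining inA─B inB─A ∷ joining inA─B inB─A ∷ []) _

  u-posimodular : u A + u B ≤ u (A ─ B) + u (B ─ A) + between (A ∩ B) (⊤ ─ (A ∪ B))
                              + between (A ∩ B) (⊤ ─ (A ∪ B))
  u-posimodular
    rewrite u-represented A-rep | u-represented B-rep | u-represented A─B-rep | u-represented B─A-rep
          | between-represented A∩B-rep neither-rep
    = count-≤ (unsafeOnly (crossing inA) ∷ unsafeOnly (crossing inB) ∷ [])
              (unsafeOnly (crossing inA─B) ∷ unsafeOnly (crossing inB─A)
                 ∷ joining inA∩B neither ∷ joining inA∩B neither ∷ []) _

  uA≤u[A∩B]+u[A─B] : u A ≤ u (A ∩ B) + u (A ─ B)
  uA≤u[A∩B]+u[A─B]
    rewrite u-represented A-rep | u-represented A∩B-rep | u-represented A─B-rep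
    = count-≤ (unsafeOnly (crossing inA) ∷ [])
              (unsafeOnly (crossing inA∩B) ∷ unsafeOnly (crossing inA─B) ∷ []) _

  uB≤u[A∩B]+u[B─A] : u B ≤ u (A ∩ B) + u (B ─ A)
  uB≤u[A∩B]+u[B─A]
    rewrite u-represented B-rep | u-represented A∩B-rep | u-represented B─A-rep
    = count-≤ (unsafeOnly (crossing inB) ∷ [])
              (unsafeOnly (crossing inA∩B) ∷ unsafeOnly (crossing inB─A) ∷ []) _

  uB≤u[A─B]+u[A∪B] : u B ≤ u (A ─ B) + u (A ∪ B)
  uB≤u[A─B]+u[A∪B]
    rewrite u-represented B-rep | u-represented A─B-rep | u-represented A∪B-rep
    = count-≤ (unsafeOnly (crossing inB) ∷ [])
              (unsafeOnly (crossing inA─B) ∷ unsafeOnly (crossing inA∪B) ∷ []) _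

  uA≤u[A∪B]+u[B─A] : u A ≤ u (A ∪ B) + u (B ─ A)
  uA≤u[A∪B]+u[B─A]
    rewrite u-represented A-rep | u-represented A∪B-rep | u-represented B─A-rep
    = count-≤ (unsafeOnly (crossing inA) ∷ [])
              (unsafeOnly (crossing inA∪B) ∷ unsafeOnly (crossing inB─A) ∷ []) _

module ThreeSets (G : Graph) (C S₁ S₂ : Subset (n G)) (S₁⊆S₂ : S₁ ⊆ S₂) where
  open Cuts G

  label : Fin (n G) → Vec Bool 3
  label v = v ∈ᵇ C ∷ v ∈ᵇ S₁ ∷ v ∈ᵇ S₂ ∷ []

  inC inS₁ inS₂ : Vec Bool 3 → Bool
  inC (c ∷ _)           = c
  inS₁ (_ ∷ s₁ ∷ _)     = s₁
  inS₂ (_ ∷ _ ∷ s₂ ∷ []) = s₂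

  nested : Vec Bool 3 → Bool
  nested x = not (inS₁ x) ∨ inS₂ x

  label-nested : ∀ v → T (nested (label v))
  label-nested v with v ∈ᵇ S₁ in v∈S₁
  ... | false = _
  ... | true  = Equivalence.from T-≡ ([]=⇒lookup (S₁⊆S₂ (lookup⇒[]= v S₁ v∈S₁)))

  open Labelling G label
  open Counting nested label-nested

  inRest inC∩S₁ inC─S₁ inC─S₂ inS₁─C outsideC∪S₁ outsideC∪S₂ : Vec Bool 3 → Bool
  inRest x      = inS₂ x ∧ not (inS₁ x ∨ inC x)
  inC∩S₁ x      = inC x ∧ inS₁ x
  inC─S₁ x      = inC x ∧ not (inS₁ x)
  inC─S₂ x      = inC x ∧ not (inS₂ x)
  inS₁─C x      = inS₁ x ∧ not (inC x)
  outsideC∪S₁ x = true ∧ not (inC x ∨ inS₁ x)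
  outsideC∪S₂ x = true ∧ not (inC x ∨ inS₂ x)

  C-rep : Represents C inC
  C-rep = represents λ _ → refl

  S₁-rep : Represents S₁ inS₁
  S₁-rep = represents λ _ → refl

  S₂-rep : Represents S₂ inS₂
  S₂-rep = represents λ _ → refl

  rest-rep : Represents (S₂ ─ (S₁ ∪ C)) inRest
  rest-rep = ─-represents S₂-rep (∪-represents S₁-rep C-rep)

  C∩S₁-rep : Represents (C ∩ S₁) inC∩S₁
  C∩S₁-rep = ∩-represents C-rep S₁-rep

  C─S₁-rep : Represents (C ─ S₁) inC─S₁
  C─S₁-rep = ─-represents C-rep S₁-rep

  C─S₂-rep : Represents (C ─ S₂) inC─S₂
  C─S₂-rep = ─-represents C-rep S₂-rep

  S₁─C-rep : Represents (S₁ ─ C) inS₁─C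
  S₁─C-rep = ─-represents S₁-rep C-rep

  outsideC∪S₁-rep : Represents (⊤ ─ (C ∪ S₁)) outsideC∪S₁
  outsideC∪S₁-rep = ─-represents ⊤-represents (∪-represents C-rep S₁-rep)

  outsideC∪S₂-rep : Represents (⊤ ─ (C ∪ S₂)) outsideC∪S₂
  outsideC∪S₂-rep = ─-represents ⊤-represents (∪-represents C-rep S₂-rep)

  d-nested : d (S₂ ─ (S₁ ∪ C)) + between (S₁ ─ C) (⊤ ─ (C ∪ S₂))
                                + between (S₁ ─ C) (⊤ ─ (C ∪ S₂))
             + d (C ∩ S₁) + d (C ─ S₂) ≤ d C + d S₁ + d S₂
  d-nested
    rewrite d-represented rest-rep | between-represented S₁─C-rep outsideC∪S₂-rep
          | d-represented C∩S₁-rep | d-represented C─S₂-rep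
          | d-represented C-rep | d-represented S₁-rep | d-represented S₂-rep
    = count-≤ (crossing inRest ∷ joining inS₁─C outsideC∪S₂ ∷ joining inS₁─C outsideC∪S₂
                 ∷ crossing inC∩S₁ ∷ crossing inC─S₂ ∷ [])
              (crossing inC ∷ crossing inS₁ ∷ crossing inS₂ ∷ []) _

  uS₁-cover : u S₁ ≤ unsafeBetween (C ∩ S₁) (C ─ S₁) + between (C ∩ S₁) (⊤ ─ (C ∪ S₁))
               + between (C ─ S₁) (S₁ ─ C) + unsafeBetween (S₁ ─ C) (S₂ ─ (S₁ ∪ C))
               + unsafeBetween (S₁ ─ C) (⊤ ─ (C ∪ S₂))
  uS₁-cover
    rewrite u-represented S₁-rep | unsafeBetween-represented C∩S₁-rep C─S₁-rep
          | between-represented C∩S₁-rep outsideC∪S₁-rep | between-represented C─S₁-rep S₁─C-rep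
          | unsafeBetween-represented S₁─C-rep rest-rep
          | unsafeBetween-represented S₁─C-rep outsideC∪S₂-rep
    = count-≤ (unsafeOnly (crossing inS₁) ∷ [])
              (unsafeOnly (joining inC∩S₁ inC─S₁) ∷ joining inC∩S₁ outsideC∪S₁
                 ∷ joining inC─S₁ inS₁─C ∷ unsafeOnly (joining inS₁─C inRest)
                 ∷ unsafeOnly (joining inS₁─C outsideC∪S₂) ∷ []) _

  unsafeBetween-S₁─C-rest≤u-rest : unsafeBetween (S₁ ─ C) (S₂ ─ (S₁ ∪ C)) ≤ u (S₂ ─ (S₁ ∪ C))
  unsafeBetween-S₁─C-rest≤u-rest
    rewrite unsafeBetween-represented S₁─C-rep rest-rep | u-represented rest-rep
    = count-≤ (unsafeOnly (joining inS₁─C inRest) ∷ []) (unsafeOnly (crossing inRest) ∷ []) _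

-- Arithmetic of cut sizes

ViolatedCounts : ℕ → ℕ → ℕ → Set
ViolatedCounts p d u = (d ≡ p + 2) × (3 ≤ u)

data Uncrossed (VX VY Va Vb Tight : Set) : Set where
  meet-join   : VX × VY → Uncrossed VX VY Va Vb Tight
  differences : Va × Vb → Uncrossed VX VY Va Vb Tight
  tight       : Tight → VX ⊎ VY → Va ⊎ Vb → Uncrossed VX VY Va Vb Tight

tight-unless : ∀ {VX VY Va Vb Tight} → Uncrossed VX VY Va Vb Tight → ¬ VX → ¬ Va → Tight
tight-unless (meet-join (X-viol , _))   ¬X-viol _       = ⊥-elim (¬X-viol X-viol)
tight-unless (differences (a-viol , _)) _       ¬a-viol = ⊥-elim (¬a-viol a-viol)
tight-unless (tight t _ _)              _       _       = t

data Split (x y s : ℕ) : Set where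
  left-zero  : x ≡ 0 → Split x y s
  right-zero : y ≡ 0 → Split x y s
  balanced   : x ≡ 2 → y ≡ 2 → s ≡ 0 → Split x y s
  lopsided   : ¬ 2 ∣ x → x ≤ 1 ⊎ y ≤ 1 → Split x y s

split : ∀ x y s → x + y + s * 2 ≡ 4 → Split x y s
split zero    y    s             _ = left-zero refl
split (suc x) zero s             _ = right-zero refl
split 1 1 0             ()
split 1 1 1             _ = lopsided (from-no (2 ∣? 1)) (inj₁ ≤-refl)
split 1 1 (suc (suc s)) ()
split 1 2 0             ()
split 1 2 (suc s)       ()
split 1 3 0             _ = lopsided (from-no (2 ∣? 1)) (inj₁ ≤-refl)
split 1 3 (suc s)       ()
split 1 (suc (suc (suc (suc y)))) s ()
split 2 1 0             ()
split 2 1 (suc s)       ()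
split 2 2 0             _ = balanced refl refl refl
split 2 2 (suc s)       ()
split 2 (suc (suc (suc y))) s ()
split 3 1 0             _ = lopsided (from-no (2 ∣? 3)) (inj₂ ≤-refl)
split 3 1 (suc s)       ()
split 3 (suc (suc y)) s ()
split 4 (suc y) s ()
split (suc (suc (suc (suc (suc x))))) (suc y) s ()

few-unsafe : ∀ {u t} → 2 ⊓ u ≤ t → t ≤ 1 → u ≤ t
few-unsafe {zero}        _   _   = z≤n
few-unsafe {1}           1≤t _   = 1≤t
few-unsafe {suc (suc u)} 2≤t t≤1 = ⊥-elim (from-no (2 ≤? 1) (≤-trans 2≤t t≤1))

no-unsafe : ∀ {u t} → 2 ⊓ u ≤ t → t ≡ 0 → u ≤ 0
no-unsafe 2⊓u≤t refl = few-unsafe 2⊓u≤t z≤n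

at-most-one-unsafe : ∀ {u t} → 2 ⊓ u ≤ t → t ≤ 1 → u ≤ 1
at-most-one-unsafe 2⊓u≤t t≤1 = ≤-trans (few-unsafe 2⊓u≤t t≤1) t≤1

many-unsafe : ∀ {u t} → 3 ≤ u → 2 ⊓ u ≤ t → 2 ≤ t
many-unsafe {suc (suc (suc u))} _ 2≤t = 2≤t
many-unsafe {1}                 (s≤s ())
many-unsafe {2}                 (s≤s (s≤s ()))

≤-dropˡ : ∀ {a x y} → a ≤ x + y → x ≤ 0 → a ≤ y
≤-dropˡ {y = y} a≤x+y x≤0 = ≤-trans a≤x+y (+-monoˡ-≤ y x≤0)

≤-dropʳ : ∀ {a x y} → a ≤ x + y → y ≤ 0 → a ≤ x
≤-dropʳ {x = x} a≤x+y y≤0 =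
  ≤-trans a≤x+y (≤-trans (+-monoʳ-≤ x y≤0) (≤-reflexive (+-identityʳ x)))

≤-drop-twice : ∀ {a b s} → a ≤ b + s + s → s ≡ 0 → a ≤ b
≤-drop-twice {b = b} a≤b+0+0 refl =
  ≤-trans a≤b+0+0 (≤-reflexive (trans (+-identityʳ _) (+-identityʳ b)))

≤-drop-three : ∀ {w a b c x y} → w ≤ a + b + c + x + y → a ≡ 0 → b ≡ 0 → c ≡ 0 → w ≤ x + y
≤-drop-three w≤x+y refl refl refl = w≤x+y

pigeonhole : ∀ {a b} → 6 ≤ a + b → 3 ≤ a ⊎ 3 ≤ b
pigeonhole {a} {b} 6≤a+b with 3 ≤? a | 3 ≤? b
... | yes 3≤a | _       = inj₁ 3≤a
... | no  _   | yes 3≤b = inj₂ 3≤b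
... | no  3≰a | no  3≰b =
  ⊥-elim (from-no (6 ≤? 4) (≤-trans 6≤a+b (+-mono-≤ (≤-pred (≰⇒> 3≰a)) (≤-pred (≰⇒> 3≰b)))))

too-few : ∀ {w x y} → 3 ≤ w → w ≤ x + y → x ≤ 1 → y ≤ 1 → ⊥
too-few 3≤w w≤x+y x≤1 y≤1 =
  from-no (3 ≤? 2) (≤-trans 3≤w (≤-trans w≤x+y (+-mono-≤ x≤1 y≤1)))

2∣2+n⇒2∣n : ∀ {n} → 2 ∣ 2 + n → 2 ∣ n
2∣2+n⇒2∣n 2∣2+n = ∣m+n∣m⇒∣n 2∣2+n ∣-refl

excess : ∀ p {c d} → p + c ≤ d → d ≡ p + (d ∸ p)
excess p {c} p+c≤d = sym (m+[n∸m]≡n (≤-trans (m≤m+n p c) p+c≤d))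

excess-bound : ∀ p {c d} → p + c ≤ d → c ≤ d ∸ p
excess-bound p {c} p+c≤d = +-cancelˡ-≤ p c _ (subst (p + c ≤_) (excess p p+c≤d) p+c≤d)

excess-2 : ∀ {p d t} → d ≡ p + t → t ≡ 2 → d ≡ p + 2
excess-2 {p} d≡p+t t≡2 = trans d≡p+t (cong (p +_) t≡2)

excess-sum : ∀ {p dA dB dX dY x y s} → dA ≡ p + 2 → dB ≡ p + 2 → dX ≡ p + x → dY ≡ p + y →
  dX + dY + s + s ≡ dA + dB → x + y + s * 2 ≡ 4
excess-sum {p} {x = x} {y} {s} refl refl refl refl sum≡ = +-cancelˡ-≡ (p + p) _ _ (begin
  p + p + (x + y + s * 2)  ≡⟨ regroup p x y s ⟩
  p + x + (p + y) + s + s  ≡⟨ sum≡ ⟩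
  p + 2 + (p + 2)          ≡⟨ regroup-4 p ⟩
  p + p + 4                ∎)
  where
  open ≡-Reasoning
  regroup : ∀ p x y s → p + p + (x + y + s * 2) ≡ p + x + (p + y) + s + s
  regroup = solve-∀
  regroup-4 : ∀ p → p + 2 + (p + 2) ≡ p + p + 4
  regroup-4 = solve-∀

excess-parity : ∀ {p dA dX da x y e} → 2 ∣ p → dA ≡ p + 2 → dX ≡ p + x → da ≡ p + y →
  dX + da ≡ dA + e + e → 2 ∣ x + y
excess-parity {p} {x = x} {y = y} {e} 2∣p refl refl refl sum≡ = ∣m+n∣m⇒∣n 2∣p+x+y 2∣p
  where
  open ≡-Reasoning
  regroup : ∀ p x y → p + (p + (x + y)) ≡ p + x + (p + y)
  regroup = solve-∀
  double : ∀ p e → p + 2 + e + e ≡ p + suc e * 2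
  double = solve-∀
  2∣p+x+y : 2 ∣ p + (x + y)
  2∣p+x+y = divides (suc e) (+-cancelˡ-≡ p _ _ (begin
    p + (p + (x + y))  ≡⟨ regroup p x y ⟩
    p + x + (p + y)    ≡⟨ sum≡ ⟩
    p + 2 + e + e      ≡⟨ double p e ⟩
    p + suc e * 2      ∎))

both-violated : ∀ {p dx dy x y s ux uy} → dx ≡ p + x → dy ≡ p + y → Split x y s →
  2 ⊓ ux ≤ x → 2 ⊓ uy ≤ y → 3 ≤ ux → 3 ≤ uy → ViolatedCounts p dx ux × ViolatedCounts p dy uy
both-violated dx≡ dy≡ x/y bx by 3≤ux 3≤uy with many-unsafe 3≤ux bx | many-unsafe 3≤uy by | x/y
... | 2≤x | _   | left-zero refl        = ⊥-elim (from-no (2 ≤? 0) 2≤x)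
... | _   | 2≤y | right-zero refl       = ⊥-elim (from-no (2 ≤? 0) 2≤y)
... | _   | _   | balanced x≡2 y≡2 _    = (excess-2 dx≡ x≡2 , 3≤ux) , (excess-2 dy≡ y≡2 , 3≤uy)
... | 2≤x | _   | lopsided _ (inj₁ x≤1) = ⊥-elim (from-no (2 ≤? 1) (≤-trans 2≤x x≤1))
... | _   | 2≤y | lopsided _ (inj₂ y≤1) = ⊥-elim (from-no (2 ≤? 1) (≤-trans 2≤y y≤1))

one-violated : ∀ {p dx dy x y ux uy} → dx ≡ p + x → dy ≡ p + y → x ≡ 2 → y ≡ 2 → 6 ≤ ux + uy →
  ViolatedCounts p dx ux ⊎ ViolatedCounts p dy uy
one-violated dx≡ dy≡ x≡2 y≡2 6≤ux+uy with pigeonhole 6≤ux+uy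
... | inj₁ 3≤ux = inj₁ (excess-2 dx≡ x≡2 , 3≤ux)
... | inj₂ 3≤uy = inj₂ (excess-2 dy≡ y≡2 , 3≤uy)

-- X = A ∩ B, Y = A ∪ B, a = A ─ B, b = B ─ A; d, t and u are the cut sizes, their excesses over p and
-- their numbers of unsafe edges; s and r count the edges between a and b and between X and V ─ Y.
module UncrossingArithmetic
  {p dX dY da db tX tY ta tb s r uA uB uX uY ua ub : ℕ}
  (dX≡ : dX ≡ p + tX) (dY≡ : dY ≡ p + tY) (da≡ : da ≡ p + ta) (db≡ : db ≡ p + tb)
  (boundX : 2 ⊓ uX ≤ tX) (boundY : 2 ⊓ uY ≤ tY) (bounda : 2 ⊓ ua ≤ ta) (boundb : 2 ⊓ ub ≤ tb)
  (meet-join-sum : tX + tY + s * 2 ≡ 4) (differences-sum : ta + tb + r * 2 ≡ 4) (parity : 2 ∣ tX + ta)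
  (3≤uA : 3 ≤ uA) (3≤uB : 3 ≤ uB)
  (uA≤X+a : uA ≤ uX + ua) (uB≤X+b : uB ≤ uX + ub) (uB≤a+Y : uB ≤ ua + uY) (uA≤Y+b : uA ≤ uY + ub)
  (uA+uB≤X+Y : uA + uB ≤ uX + uY + s + s) (uA+uB≤a+b : uA + uB ≤ ua + ub + r + r)
  where

  6≤uA+uB : 6 ≤ uA + uB
  6≤uA+uB = +-mono-≤ 3≤uA 3≤uB

  both-small : tX ≤ 1 ⊎ tY ≤ 1 → ta ≤ 1 ⊎ tb ≤ 1 → ⊥
  both-small (inj₁ tX≤1) (inj₁ ta≤1) =
    too-few 3≤uA uA≤X+a (at-most-one-unsafe boundX tX≤1) (at-most-one-unsafe bounda ta≤1)
  both-small (inj₁ tX≤1) (inj₂ tb≤1) =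
    too-few 3≤uB uB≤X+b (at-most-one-unsafe boundX tX≤1) (at-most-one-unsafe boundb tb≤1)
  both-small (inj₂ tY≤1) (inj₁ ta≤1) =
    too-few 3≤uB uB≤a+Y (at-most-one-unsafe bounda ta≤1) (at-most-one-unsafe boundY tY≤1)
  both-small (inj₂ tY≤1) (inj₂ tb≤1) =
    too-few 3≤uA uA≤Y+b (at-most-one-unsafe boundY tY≤1) (at-most-one-unsafe boundb tb≤1)

  uncross : Uncrossed (ViolatedCounts p dX uX) (ViolatedCounts p dY uY)
                      (ViolatedCounts p da ua) (ViolatedCounts p db ub)
                      ((s ≡ 0) × (r ≡ 0) × (dX ≡ p + 2) × (da ≡ p + 2))
  uncross with split tX tY s meet-join-sum | split ta tb r differences-sum
  ... | left-zero tX≡0 | a/b = differences (both-violated da≡ db≡ a/b bounda boundb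
          (≤-trans 3≤uA (≤-dropˡ uA≤X+a (no-unsafe boundX tX≡0)))
          (≤-trans 3≤uB (≤-dropˡ uB≤X+b (no-unsafe boundX tX≡0))))
  ... | right-zero tY≡0 | a/b = differences (both-violated da≡ db≡ a/b bounda boundb
          (≤-trans 3≤uB (≤-dropʳ uB≤a+Y (no-unsafe boundY tY≡0)))
          (≤-trans 3≤uA (≤-dropˡ uA≤Y+b (no-unsafe boundY tY≡0))))
  ... | X/Y | left-zero ta≡0 = meet-join (both-violated dX≡ dY≡ X/Y boundX boundY
          (≤-trans 3≤uA (≤-dropʳ uA≤X+a (no-unsafe bounda ta≡0)))
          (≤-trans 3≤uB (≤-dropˡ uB≤a+Y (no-unsafe bounda ta≡0))))
  ... | X/Y | right-zero tb≡0 = meet-join (both-violated dX≡ dY≡ X/Y boundX boundY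
          (≤-trans 3≤uB (≤-dropʳ uB≤X+b (no-unsafe boundb tb≡0)))
          (≤-trans 3≤uA (≤-dropʳ uA≤Y+b (no-unsafe boundb tb≡0))))
  ... | balanced tX≡2 tY≡2 s≡0 | balanced ta≡2 tb≡2 r≡0 = tight
          (s≡0 , r≡0 , excess-2 dX≡ tX≡2 , excess-2 da≡ ta≡2)
          (one-violated dX≡ dY≡ tX≡2 tY≡2 (≤-trans 6≤uA+uB (≤-drop-twice uA+uB≤X+Y s≡0)))
          (one-violated da≡ db≡ ta≡2 tb≡2 (≤-trans 6≤uA+uB (≤-drop-twice uA+uB≤a+b r≡0)))
  ... | balanced tX≡2 _ _ | lopsided 2∤ta _ =
          ⊥-elim (2∤ta (2∣2+n⇒2∣n (subst (λ t → 2 ∣ t + ta) tX≡2 parity)))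
  ... | lopsided 2∤tX _ | balanced ta≡2 _ _ =
          ⊥-elim (2∤tX (2∣2+n⇒2∣n (subst (2 ∣_) (+-comm tX 2)
                                         (subst (λ t → 2 ∣ tX + t) ta≡2 parity))))
  ... | lopsided _ small-X/Y | lopsided _ small-a/b = ⊥-elim (both-small small-X/Y small-a/b)

unviolated-few-unsafe : ∀ {p d u} → d ≡ p + 2 → ¬ ViolatedCounts p d u → u ≤ 2
unviolated-few-unsafe {u = u} d≡p+2 ¬violated with 3 ≤? u
... | yes 3≤u = ⊥-elim (¬violated (d≡p+2 , 3≤u))
... | no  3≰u = ≤-pred (≰⇒> 3≰u)

no-inner-edges : ∀ {a b c q} → 3 ≤ a → b ≤ 2 → c ≤ 2 → a + q + q ≤ b + c → q ≡ 0
no-inner-edges {q = zero}  _   _   _   _        = refl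
no-inner-edges {q = suc q} 3≤a b≤2 c≤2 a+q+q≤b+c = ⊥-elim (from-no (5 ≤? 4)
  (≤-trans (+-mono-≤ (+-mono-≤ 3≤a (s≤s z≤n)) (s≤s z≤n))
           (≤-trans a+q+q≤b+c (+-mono-≤ b≤2 c≤2))))

cancel-three : ∀ {p x d₁ d₂ d₃ d₄ d₅} →
  d₁ ≡ p + 2 → d₂ ≡ p + 2 → d₃ ≡ p + 2 → d₄ ≡ p + 2 → d₅ ≡ p + 2 →
  x + d₁ + d₂ ≤ d₃ + d₄ + d₅ → x ≤ p + 2
cancel-three {p} {x} refl refl refl refl refl x+q+q≤q+q+q =
  +-cancelʳ-≤ (p + 2) x (p + 2) (+-cancelʳ-≤ (p + 2) (x + (p + 2)) (p + 2 + (p + 2)) x+q+q≤q+q+q)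

nested-excess : ∀ {p d e u w₁ w₂} → d + e + e ≤ p + 2 → p + 2 ⊓ u ≤ d →
  3 ≤ w₁ + w₂ → w₁ ≤ u → w₂ ≤ e → ViolatedCounts p d u
nested-excess {p} {d} {zero} {u} d+0+0≤p+2 p+2⊓u≤d 3≤w₁+w₂ w₁≤u w₂≤0 =
  ≤-antisym (≤-trans (m≤m+n d 0) (≤-trans (m≤m+n (d + 0) 0) d+0+0≤p+2))
            (subst (λ c → p + c ≤ d) 2⊓u≡2 p+2⊓u≤d) , 3≤u
  where
  3≤u : 3 ≤ u
  3≤u = ≤-trans (≤-dropʳ 3≤w₁+w₂ w₂≤0) w₁≤u
  2⊓u≡2 : 2 ⊓ u ≡ 2
  2⊓u≡2 = m≤n⇒m⊓n≡m (≤-trans (n≤1+n 2) 3≤u)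
nested-excess {p} {d} {suc e} {u} d+e+e≤p+2 p+2⊓u≤d 3≤w₁+w₂ w₁≤u w₂≤1+e =
  ⊥-elim (too-few 3≤w₁+w₂ ≤-refl (≤-trans w₁≤u (≤-trans u≤0 z≤n))
                                  (subst (λ e → _ ≤ suc e) e≡0 w₂≤1+e))
  where
  open ≤-Reasoning
  regroup : ∀ p c e → p + (2 + (c + e + e)) ≡ p + c + suc e + suc e
  regroup = solve-∀
  2+c+e+e≤2 : 2 + (2 ⊓ u + e + e) ≤ 2
  2+c+e+e≤2 = +-cancelˡ-≤ p _ _ (begin
    p + (2 + (2 ⊓ u + e + e))  ≡⟨ regroup p (2 ⊓ u) e ⟩
    p + 2 ⊓ u + suc e + suc e  ≤⟨ +-monoˡ-≤ (suc e) (+-monoˡ-≤ (suc e) p+2⊓u≤d) ⟩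
    d + suc e + suc e          ≤⟨ d+e+e≤p+2 ⟩
    p + 2                      ∎)
  c+e+e≡0 : 2 ⊓ u + e + e ≡ 0
  c+e+e≡0 = n≤0⇒n≡0 (+-cancelˡ-≤ 2 _ 0 2+c+e+e≤2)
  c+e≡0 : 2 ⊓ u + e ≡ 0
  c+e≡0 = m+n≡0⇒m≡0 (2 ⊓ u + e) c+e+e≡0
  e≡0 : e ≡ 0
  e≡0 = m+n≡0⇒n≡0 (2 ⊓ u) c+e≡0
  u≤0 : u ≤ 0
  u≤0 = few-unsafe (≤-reflexive (m+n≡0⇒m≡0 (2 ⊓ u) c+e≡0)) z≤n

-- Pliability

module CrossingViolatedSets (G : Graph) {p} (p-even : 2 ∣ p) (flex : FlexConnected G p)
                            (A B : Subset (n G)) (A-violated : Violated G p A) (B-violated : Violated G p B)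
                            (A⋈B : Cross A B) where
  open Cuts G
  open TwoSets G A B

  A─B≠∅ : Nonempty (A ─ B)
  A─B≠∅ = proj₁ A⋈B
  A∩B≠∅ : Nonempty (A ∩ B)
  A∩B≠∅ = proj₁ (proj₂ A⋈B)
  B─A≠∅ : Nonempty (B ─ A)
  B─A≠∅ = proj₁ (proj₂ (proj₂ A⋈B))
  A∪B≠V : Nonempty (⊤ ─ (A ∪ B))
  A∪B≠V = proj₂ (proj₂ (proj₂ A⋈B))

  flex-A∩B : p + 2 ⊓ u (A ∩ B) ≤ d (A ∩ B)
  flex-A∩B = flex-bound flex A∩B≠∅ (disjoint⇒complement-nonempty
    (λ x∈A─B x∈A∩B → x∈p─q⇒x∉q x∈A─B (p∩q⊆q A B x∈A∩B)) A─B≠∅)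

  flex-A∪B : p + 2 ⊓ u (A ∪ B) ≤ d (A ∪ B)
  flex-A∪B =
    flex-bound flex (Nonempty-mono (λ x∈A∩B → p⊆p∪q B (p∩q⊆p A B x∈A∩B)) A∩B≠∅) A∪B≠V

  flex-A─B : p + 2 ⊓ u (A ─ B) ≤ d (A ─ B)
  flex-A─B = flex-bound flex A─B≠∅ (disjoint⇒complement-nonempty
    (λ x∈A∩B x∈A─B → x∈p─q⇒x∉q x∈A─B (p∩q⊆q A B x∈A∩B)) A∩B≠∅)

  flex-B─A : p + 2 ⊓ u (B ─ A) ≤ d (B ─ A)
  flex-B─A = flex-bound flex B─A≠∅ (disjoint⇒complement-nonempty
    (λ x∈A∩B x∈B─A → x∈p─q⇒x∉q x∈B─A (p∩q⊆p A B x∈A∩B)) A∩B≠∅)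

  Tight : Set
  Tight = (between (A ─ B) (B ─ A) ≡ 0) × (between (A ∩ B) (⊤ ─ (A ∪ B)) ≡ 0)
        × (d (A ∩ B) ≡ p + 2) × (d (A ─ B) ≡ p + 2)

  uncross : Uncrossed (Violated G p (A ∩ B)) (Violated G p (A ∪ B))
                      (Violated G p (A ─ B)) (Violated G p (B ─ A)) Tight
  uncross = UncrossingArithmetic.uncross
    (excess p flex-A∩B) (excess p flex-A∪B) (excess p flex-A─B) (excess p flex-B─A)
    (excess-bound p flex-A∩B) (excess-bound p flex-A∪B) (excess-bound p flex-A─B) (excess-bound p flex-B─A)
    (excess-sum (proj₁ A-violated) (proj₁ B-violated) (excess p flex-A∩B) (excess p flex-A∪B) d-submodular)
    (excess-sum (proj₁ A-violated) (proj₁ B-violated) (excess p flex-A─B) (excess p flex-B─A) d-posimodular)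
    (excess-parity p-even (proj₁ A-violated) (excess p flex-A∩B) (excess p flex-A─B) d-split)
    (proj₂ A-violated) (proj₂ B-violated)
    uA≤u[A∩B]+u[A─B] uB≤u[A∩B]+u[B─A] uB≤u[A─B]+u[A∪B] uA≤u[A∪B]+u[B─A]
    u-submodular u-posimodular

module _ {k} (𝓕 : Family k) {Y X a b : Subset k} where

  meet-join-in : 𝓕 X × 𝓕 Y → AtLeastTwoOf4 𝓕 Y X a b
  meet-join-in (X∈𝓕 , Y∈𝓕) = 1F , 0F , (λ ()) , X∈𝓕 , Y∈𝓕

  differences-in : 𝓕 a × 𝓕 b → AtLeastTwoOf4 𝓕 Y X a b
  differences-in (a∈𝓕 , b∈𝓕) = 2F , 3F , (λ ()) , a∈𝓕 , b∈𝓕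

  two-of-four : ∀ {Tight} → Uncrossed (𝓕 X) (𝓕 Y) (𝓕 a) (𝓕 b) Tight → AtLeastTwoOf4 𝓕 Y X a b
  two-of-four (meet-join X,Y∈𝓕)                  = meet-join-in X,Y∈𝓕
  two-of-four (differences a,b∈𝓕)                = differences-in a,b∈𝓕
  two-of-four (tight _ (inj₁ X∈𝓕) (inj₁ a∈𝓕)) = 1F , 2F , (λ ()) , X∈𝓕 , a∈𝓕
  two-of-four (tight _ (inj₁ X∈𝓕) (inj₂ b∈𝓕)) = 1F , 3F , (λ ()) , X∈𝓕 , b∈𝓕
  two-of-four (tight _ (inj₂ Y∈𝓕) (inj₁ a∈𝓕)) = 0F , 2F , (λ ()) , Y∈𝓕 , a∈𝓕
  two-of-four (tight _ (inj₂ Y∈𝓕) (inj₂ b∈𝓕)) = 0F , 3F , (λ ()) , Y∈𝓕 , b∈𝓕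

violated-pliable : ∀ {p} (G : Graph) → 2 ∣ p → FlexConnected G p → Pliable (Violated G p)
violated-pliable {p} G p-even flex A B A-violated B-violated
  with nonempty? (A ─ B) | nonempty? (A ∩ B) | nonempty? (B ─ A) | nonempty? (⊤ ─ (A ∪ B))
... | yes A─B≠∅ | yes A∩B≠∅ | yes B─A≠∅ | yes A∪B≠V = two-of-four (Violated G p) uncross
  where
  open CrossingViolatedSets G p-even flex A B A-violated B-violated (A─B≠∅ , A∩B≠∅ , B─A≠∅ , A∪B≠V)
... | no A─B≡∅ | _ | _ | _ = meet-join-in (Violated G p)
  ( violated-cong (A ∩ B) A (agree-off A─B-rep A∩B-rep A-rep _ A─B≡∅) A-violated
  , violated-cong (A ∪ B) B (agree-off A─B-rep A∪B-rep B-rep _ A─B≡∅) B-violated )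
  where open TwoSets G A B; open Cuts G
... | _ | no A∩B≡∅ | _ | _ = differences-in (Violated G p)
  ( violated-cong (A ─ B) A (agree-off A∩B-rep A─B-rep A-rep _ A∩B≡∅) A-violated
  , violated-cong (B ─ A) B (agree-off A∩B-rep B─A-rep B-rep _ A∩B≡∅) B-violated )
  where open TwoSets G A B; open Cuts G
... | _ | _ | no B─A≡∅ | _ = meet-join-in (Violated G p)
  ( violated-cong (A ∩ B) B (agree-off B─A-rep A∩B-rep B-rep _ B─A≡∅) B-violated
  , violated-cong (A ∪ B) A (agree-off B─A-rep A∪B-rep A-rep _ B─A≡∅) A-violated )
  where open TwoSets G A B; open Cuts G
... | _ | _ | _ | no A∪B≡V = differences-in (Violated G p)
  ( violated-cong (A ─ B) (⊤ ─ B)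
      (agree-off neither-rep A─B-rep (─-represents ⊤-represents B-rep) _ A∪B≡V)
      (violated-complement B B-violated)
  , violated-cong (B ─ A) (⊤ ─ A)
      (agree-off neither-rep B─A-rep (─-represents ⊤-represents A-rep) _ A∪B≡V)
      (violated-complement A A-violated) )
  where open TwoSets G A B; open Cuts G

-- Property γ

¬separates-pointwise : ∀ {k} (X S R : Subset k) (op : Bool → Bool → Bool) →
  (∀ v → v ∈ᵇ X ≡ op (v ∈ᵇ S) (v ∈ᵇ R)) →
  ∀ q → ¬ Separates S q → ¬ Separates R q → ¬ Separates X q
¬separates-pointwise X S R op X≗ (u , v) ¬sepS ¬sepR = ≡⇒xor≢true (begin
  u ∈ᵇ X                   ≡⟨ X≗ u ⟩
  op (u ∈ᵇ S) (u ∈ᵇ R)     ≡⟨ cong₂ op (xor≢true⇒≡ ¬sepS) (xor≢true⇒≡ ¬sepR) ⟩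
  op (v ∈ᵇ S) (v ∈ᵇ R)     ≡⟨ X≗ v ⟨
  v ∈ᵇ X                   ∎)
  where open ≡-Reasoning

minimal-no-proper : ∀ {k} {𝓕 : Family k} {C D : Subset k} {x} →
  Minimal 𝓕 C → 𝓕 D → D ⊆ C → x ∈ C → x ∉ D → ⊥
minimal-no-proper (_ , minimal) D∈𝓕 D⊆C x∈C x∉D =
  x∉D (subst (_ ∈_) (sym (minimal _ D∈𝓕 D⊆C)) x∈C)

module NestedCrossing (G : Graph) {p} (p-even : 2 ∣ p) (flex : FlexConnected G p)
  (F' : List (Fin (n G) × Fin (n G))) (C S₁ S₂ : Subset (n G))
  (C-minimal : Minimal (Restrict (Violated G p) F') C)
  (S₁-in : Restrict (Violated G p) F' S₁) (S₂-in : Restrict (Violated G p) F' S₂)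
  (C⋈S₁ : Cross C S₁) (C⋈S₂ : Cross C S₂) (S₁⊆S₂ : S₁ ⊆ S₂) where
  open Cuts G

  C-violated : Violated G p C
  C-violated = proj₁ (proj₁ C-minimal)

  module Uncrossing (S : Subset (n G)) (S-in : Restrict (Violated G p) F' S) (C⋈S : Cross C S) where
    open CrossingViolatedSets G p-even flex C S C-violated (proj₁ S-in) C⋈S public

    unseparated : ∀ (X : Subset (n G)) op → (∀ v → v ∈ᵇ X ≡ op (v ∈ᵇ C) (v ∈ᵇ S)) →
                  All (λ q → ¬ Separates X q) F'
    unseparated X op X≗ =
      All.zipWith (λ {q} (¬sepC , ¬sepS) → ¬separates-pointwise X C S op X≗ q ¬sepC ¬sepS)
                  (proj₂ (proj₁ C-minimal) , proj₂ S-in)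

    C∩S-unviolated : ¬ Violated G p (C ∩ S)
    C∩S-unviolated C∩S-violated with A─B≠∅
    ... | x , x∈C─S = minimal-no-proper C-minimal
      (C∩S-violated , unseparated (C ∩ S) _∧_ (λ v → lookup-zipWith _∧_ v C S))
      (p∩q⊆p C S) (p─q⊆p C S x∈C─S) (λ x∈C∩S → x∈p─q⇒x∉q x∈C─S (p∩q⊆q C S x∈C∩S))

    C─S-unviolated : ¬ Violated G p (C ─ S)
    C─S-unviolated C─S-violated with A∩B≠∅
    ... | x , x∈C∩S = minimal-no-proper C-minimal
      (C─S-violated , unseparated (C ─ S) (λ c s → c ∧ not s) (lookup-─ C S))
      (p─q⊆p C S) (p∩q⊆p C S x∈C∩S) (λ x∈C─S → x∈p─q⇒x∉q x∈C─S (p∩q⊆q C S x∈C∩S))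

    tightness : Tight
    tightness = tight-unless uncross C∩S-unviolated C─S-unviolated

    difference-edges≡0 : between (C ─ S) (S ─ C) ≡ 0
    difference-edges≡0 = proj₁ tightness

    outer-edges≡0 : between (C ∩ S) (⊤ ─ (C ∪ S)) ≡ 0
    outer-edges≡0 = proj₁ (proj₂ tightness)

    d[C∩S]≡p+2 : d (C ∩ S) ≡ p + 2
    d[C∩S]≡p+2 = proj₁ (proj₂ (proj₂ tightness))

    d[C─S]≡p+2 : d (C ─ S) ≡ p + 2
    d[C─S]≡p+2 = proj₂ (proj₂ (proj₂ tightness))

  module Uncrossing₁ = Uncrossing S₁ S₁-in C⋈S₁
  module Uncrossing₂ = Uncrossing S₂ S₂-in C⋈S₂

  rest outside : Subset (n G)
  rest    = S₂ ─ (S₁ ∪ C)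
  outside = ⊤ ─ (C ∪ S₂)

  rest-violated : Nonempty rest → Violated G p rest
  rest-violated rest≠∅ =
    nested-excess d[rest]+2e≤p+2 (flex-bound flex rest≠∅ rest≠V) unsafe-leaving-S₁─C
    unsafeBetween-S₁─C-rest≤u-rest (unsafeBetween≤between (S₁ ─ C) outside)
    where
    open ThreeSets G C S₁ S₂ S₁⊆S₂
    open TwoSets G C S₁ using (u-split)
    open Uncrossing₁ using (A∩B≠∅; C∩S-unviolated; C─S-unviolated; difference-edges≡0; outer-edges≡0)
      renaming (d[C∩S]≡p+2 to d[C∩S₁]≡p+2; d[C─S]≡p+2 to d[C─S₁]≡p+2)
    open Uncrossing₂ using () renaming (d[C─S]≡p+2 to d[C─S₂]≡p+2)

    rest≠V : Nonempty (⊤ ─ rest)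
    rest≠V = disjoint⇒complement-nonempty
      (λ x∈C∩S₁ x∈rest → x∈p─q⇒x∉q x∈rest (p⊆p∪q C (p∩q⊆q C S₁ x∈C∩S₁)))
      A∩B≠∅

    d[rest]+2e≤p+2 : d rest + between (S₁ ─ C) outside + between (S₁ ─ C) outside ≤ p + 2
    d[rest]+2e≤p+2 = cancel-three d[C∩S₁]≡p+2 d[C─S₂]≡p+2
      (proj₁ C-violated) (proj₁ (proj₁ S₁-in)) (proj₁ (proj₁ S₂-in)) d-nested

    inner-edges≡0 : unsafeBetween (C ∩ S₁) (C ─ S₁) ≡ 0
    inner-edges≡0 = no-inner-edges (proj₂ C-violated)
      (unviolated-few-unsafe d[C∩S₁]≡p+2 C∩S-unviolated)
      (unviolated-few-unsafe d[C─S₁]≡p+2 C─S-unviolated) u-split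

    unsafe-leaving-S₁─C : 3 ≤ unsafeBetween (S₁ ─ C) rest + unsafeBetween (S₁ ─ C) outside
    unsafe-leaving-S₁─C = ≤-trans (proj₂ (proj₁ S₁-in))
      (≤-drop-three uS₁-cover inner-edges≡0 outer-edges≡0 difference-edges≡0)

violated-γ : ∀ {p} (G : Graph) → 2 ∣ p → FlexConnected G p → PropertyGamma (Violated G p)
violated-γ G p-even flex F' C S₁ S₂ C-minimal S₁-in S₂-in C⋈S₁ C⋈S₂ S₁⊆S₂
  with nonempty? (S₂ ─ (S₁ ∪ C))
... | no  rest≡∅  = inj₁ rest≡∅
... | yes rest≠∅ = inj₂ (rest-violated rest≠∅)
  where open NestedCrossing G p-even flex F' C S₁ S₂ C-minimal S₁-in S₂-in C⋈S₁ C⋈S₂ S₁⊆S₂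

theorem1 : (p : ℕ) → 2 ∣ p → 2 ≤ p → (G : Graph) → FlexConnected G p →
    Pliable (Violated G p) × PropertyGamma (Violated G p)
theorem1 p p-even _ G flex = violated-pliable G p-even flex , violated-γ G p-even flex
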